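{- Let $Q$ be a quiver without loops and 2-cycles and $R$ an integral domain. Every non-zero frieze $\mathcal{F}\colon\mathcal{A}(Q)\to R$ is completely determined by its values on an arbitrary cluster of $\mathcal{A}(Q)$: if $\mathcal{F},\mathcal{F}'$ are non-zero friezes to $R$ and $\mathbf{x}$ is a cluster with $\mathcal{F}(x)=\mathcal{F}'(x)$ for all $x\in\mathbf{x}$, then $\mathcal{F}=\mathcal{F}'$.
   Context: $\mathcal{A}(Q)$ is the cluster algebra with trivial coefficients. A frieze of type $Q$ is a ring homomorphism $\mathcal{F}\colon\mathcal{A}(Q)\to R$ to an integral domain $R$; it is non-zero if every cluster variable of $\mathcal{A}(Q)$ is mapped to a non-zero element of $R$. -}

module Defs where

open import Level using (Level; _⊔_) renaming (suc to lsuc)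
open import Algebra.Bundles using (CommutativeRing)
open import Data.Nat using (ℕ; zero; suc)
open import Data.Integer as ℤ using (ℤ; +_; -[1+_])
open import Data.Fin using (Fin; _≟_)
open import Data.List using (List; []; _∷_)
open import Data.Product using (_×_; _,_; proj₁; proj₂)
open import Data.Sum using (_⊎_)
open import Relation.Nullary using (¬_; yes; no)
open import Relation.Binary.PropositionalEquality using (_≡_)

-- Fields (with a total inverse function, only constrained on non-zero
-- elements) and integral domains, as commutative rings with extra laws.

record Field (c ℓ : Level) : Set (lsuc (c ⊔ ℓ)) where
  field
    commutativeRing : CommutativeRing c ℓ
  open CommutativeRing commutativeRing public
  field
    _⁻¹        : Carrier → Carrier
    inverse    : ∀ x → ¬ (x ≈ 0#) → x * (x ⁻¹) ≈ 1#
    nontrivial : ¬ (1# ≈ 0#)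

record IntegralDomain (c ℓ : Level) : Set (lsuc (c ⊔ ℓ)) where
  field
    commutativeRing : CommutativeRing c ℓ
  open CommutativeRing commutativeRing public
  field
    nontrivial     : ¬ (1# ≈ 0#)
    noZeroDivisors : ∀ x y → x * y ≈ 0# → (x ≈ 0#) ⊎ (y ≈ 0#)

record Quiver (n : ℕ) : Set where
  field
    arrows    : Fin n → Fin n → ℕ
    noLoops   : ∀ i → arrows i i ≡ 0
    no2cycles : ∀ i j → (arrows i j ≡ 0) ⊎ (arrows j i ≡ 0)

exchangeMatrix : ∀ {n} → Quiver n → Fin n → Fin n → ℤ
exchangeMatrix Q i j = (+ Quiver.arrows Q i j) ℤ.- (+ Quiver.arrows Q j i)

pos : ℤ → ℕ
pos (+ m)      = m
pos -[1+ m ]   = 0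

neg : ℤ → ℕ
neg b = pos (ℤ.- b)

mutateMatrix : ∀ {n} → Fin n → (Fin n → Fin n → ℤ) → Fin n → Fin n → ℤ
mutateMatrix k B i j with i ≟ k | j ≟ k
... | yes _ | _     = ℤ.- B i j
... | no _  | yes _ = ℤ.- B i j
... | no _  | no _  =
  (B i j ℤ.+ (+ pos (B i k)) ℤ.* (+ pos (B k j)))
    ℤ.- (+ neg (B i k)) ℤ.* (+ neg (B k j))

data Poly (n : ℕ) : Set where
  pvar   : Fin n → Poly n
  pconst : ℤ → Poly n
  padd   : Poly n → Poly n → Poly n
  pmul   : Poly n → Poly n → Poly n
  pneg   : Poly n → Poly n

evalℤ : ∀ {n} → (Fin n → ℤ) → Poly n → ℤ
evalℤ a (pvar i)   = a i
evalℤ a (pconst z) = z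
evalℤ a (padd p q) = evalℤ a p ℤ.+ evalℤ a q
evalℤ a (pmul p q) = evalℤ a p ℤ.* evalℤ a q
evalℤ a (pneg p)   = ℤ.- evalℤ a p

module _ {c ℓ} (K : Field c ℓ) where
  open Field K

  natK : ℕ → Carrier
  natK zero    = 0#
  natK (suc m) = 1# + natK m

  intK : ℤ → Carrier
  intK (+ m)    = natK m
  intK -[1+ m ] = - natK (suc m)

  evalK : ∀ {n} → (Fin n → Carrier) → Poly n → Carrier
  evalK x (pvar i)   = x i
  evalK x (pconst z) = intK z
  evalK x (padd p q) = evalK x p + evalK x q
  evalK x (pmul p q) = evalK x p * evalK x q
  evalK x (pneg p)   = - evalK x p

  -- an integer polynomial vanishing at x is the zero polynomial
  -- (a polynomial over ℤ is zero iff it vanishes on all of ℤⁿ)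
  AlgIndependent : ∀ {n} → (Fin n → Carrier) → Set ℓ
  AlgIndependent {n} x =
    ∀ (p : Poly n) → evalK x p ≈ 0# → ∀ (a : Fin n → ℤ) → evalℤ a p ≡ + 0

  pow : Carrier → ℕ → Carrier
  pow y zero    = 1#
  pow y (suc m) = y * pow y m

  prodFin : ∀ {n} → (Fin n → Carrier) → Carrier
  prodFin {zero}  f = 1#
  prodFin {suc n} f = f Fin.zero * prodFin (λ i → f (Fin.suc i))

-- The cluster algebra A(Q) with trivial coefficients, realised inside a
-- field K, with initial cluster x₀ (algebraically independent in use).

module Cluster {c ℓ} (K : Field c ℓ) {n : ℕ} (Q : Quiver n)
               (x₀ : Fin n → Field.Carrier K) where
  open Field K

  Seed : Set c
  Seed = (Fin n → Carrier) × (Fin n → Fin n → ℤ)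

  mutateCluster : Fin n → Seed → Fin n → Carrier
  mutateCluster k (x , B) i with i ≟ k
  ... | yes _ = (prodFin K (λ j → pow K (x j) (pos (B j k)))
                 + prodFin K (λ j → pow K (x j) (neg (B j k)))) * (x k ⁻¹)
  ... | no _  = x i

  mutate : Fin n → Seed → Seed
  mutate k s = mutateCluster k s , mutateMatrix k (proj₂ s)

  initialSeed : Seed
  initialSeed = x₀ , exchangeMatrix Q

  seedAt : List (Fin n) → Seed
  seedAt []       = initialSeed
  seedAt (k ∷ ks) = mutate k (seedAt ks)

  cluster : List (Fin n) → Fin n → Carrier
  cluster ks = proj₁ (seedAt ks)

  data InA : Carrier → Set c where
    var  : ∀ ks i → InA (cluster ks i)
    zro  : InA 0#
    one  : InA 1#
    add  : ∀ {a b} → InA a → InA b → InA (a + b)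
    mul  : ∀ {a b} → InA a → InA b → InA (a * b)
    negA : ∀ {a} → InA a → InA (- a)

  module _ {c' ℓ'} (R : IntegralDomain c' ℓ') where
    private module R = IntegralDomain R

    record Frieze : Set (c ⊔ ℓ ⊔ c' ⊔ ℓ') where
      field
        map     : ∀ {a} → InA a → R.Carrier
        map-cong : ∀ {a b} (p : InA a) (q : InA b) → a ≈ b → map p R.≈ map q
        map-0   : map zro R.≈ R.0#
        map-1   : map one R.≈ R.1#
        map-+   : ∀ {a b} (p : InA a) (q : InA b) → map (add p q) R.≈ map p R.+ map q
        map-*   : ∀ {a b} (p : InA a) (q : InA b) → map (mul p q) R.≈ map p R.* map q
        map-neg : ∀ {a} (p : InA a) → map (negA p) R.≈ R.- map p

    NonZero : Frieze → Set ℓ'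
    NonZero F = ∀ ks i → ¬ (Frieze.map F (var ks i) R.≈ R.0#)

module Submission where

-- Each exchange relation  x_k x_k' = P⁺ + P⁻  holds in A(Q), and its image under a frieze
-- lets one value of the pair (x_k, x_k') be recovered from the other by cancelling a non-zero
-- factor in the integral domain R: x_k' from the rest of its seed, and x_k from the mutated
-- seed, since x_k itself never occurs in P± (the exchange matrix has zero diagonal). Walking
-- along the mutation sequence, agreement on one cluster propagates back to the initial
-- cluster and from there to every cluster, hence to the subring they generate.

open import Defs
open import Data.Fin using (Fin; _≟_)
open import Data.List using (List; []; _∷_)
open import Data.Nat using (zero; suc)
open import Data.Integer as ℤ using (ℤ; +_; -[1+_])
open import Data.Integer.Properties using (neg-involutive)
open import Data.Integer.Solver using (module +-*-Solver)
open import Data.Product using (_×_; _,_; proj₁; proj₂)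
open import Data.Sum using (_⊎_; inj₁; inj₂)
open import Data.Empty using (⊥-elim)
open import Relation.Nullary using (¬_; Dec; yes; no)
open import Relation.Binary.PropositionalEquality using (_≡_; refl; cong; sym; subst)
import Algebra.Properties.Ring as RingProperties
import Relation.Binary.Reasoning.Setoid as SetoidReasoning

Skew : ∀ {n} → (Fin n → Fin n → ℤ) → Set
Skew B = ∀ i j → B j i ≡ ℤ.- B i j

exchangeMatrix-skew : ∀ {n} (Q : Quiver n) → Skew (exchangeMatrix Q)
exchangeMatrix-skew Q i j =
  solve 2 (λ a b → b :- a := :- (a :- b)) refl
    (+ Quiver.arrows Q i j) (+ Quiver.arrows Q j i)
  where open +-*-Solver

-- Uses pos (- b) = neg b (definitionally) and neg (- b) = pos b.
mutatedEntry-skew : ∀ bij bik bkj →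
  (ℤ.- bij ℤ.+ + pos (ℤ.- bkj) ℤ.* + pos (ℤ.- bik))
    ℤ.- + neg (ℤ.- bkj) ℤ.* + neg (ℤ.- bik)
  ≡ ℤ.- ((bij ℤ.+ + pos bik ℤ.* + pos bkj) ℤ.- + neg bik ℤ.* + neg bkj)
mutatedEntry-skew bij bik bkj
  rewrite neg-involutive bkj | neg-involutive bik =
  solve 5 (λ b p₁ p₂ n₁ n₂ → ((:- b) :+ n₂ :* n₁) :- p₂ :* p₁
                            := :- ((b :+ p₁ :* p₂) :- n₁ :* n₂))
    refl bij (+ pos bik) (+ pos bkj) (+ neg bik) (+ neg bkj)
  where open +-*-Solver

mutateMatrix-skew : ∀ {n} (k : Fin n) {B : Fin n → Fin n → ℤ} →
  Skew B → Skew (mutateMatrix k B)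
mutateMatrix-skew k {B} skew i j with i ≟ k | j ≟ k
... | yes _ | yes _ = cong ℤ.-_ (skew i j)
... | yes _ | no _  = cong ℤ.-_ (skew i j)
... | no _  | yes _ = cong ℤ.-_ (skew i j)
... | no _  | no _
  rewrite skew i j | skew k j | skew i k = mutatedEntry-skew (B i j) (B i k) (B k j)

skew⇒pos-diagonal≡0 : ∀ {n} {B : Fin n → Fin n → ℤ} → Skew B → ∀ i → pos (B i i) ≡ 0
skew⇒pos-diagonal≡0 {B = B} skew i with B i i | skew i i
... | + zero   | _  = refl
... | + suc _  | ()
... | -[1+ _ ] | _  = refl

skew⇒neg-diagonal≡0 : ∀ {n} {B : Fin n → Fin n → ℤ} → Skew B → ∀ i → neg (B i i) ≡ 0
skew⇒neg-diagonal≡0 skew i =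
  subst (λ b → pos b ≡ 0) (skew i i) (skew⇒pos-diagonal≡0 skew i)

module _ {c ℓ} (R : IntegralDomain c ℓ) where
  open IntegralDomain R
  open RingProperties ring using (x[y-z]≈xy-xz; x≈y⇒x∙y⁻¹≈ε; x∙y⁻¹≈ε⇒x≈y)

  *-cancelˡ-nonZero : ∀ a {u v} → ¬ (a ≈ 0#) → a * u ≈ a * v → u ≈ v
  *-cancelˡ-nonZero a {u} {v} a≉0 au≈av
    with noZeroDivisors a (u - v) (trans (x[y-z]≈xy-xz a u v) (x≈y⇒x∙y⁻¹≈ε au≈av))
  ... | inj₁ a≈0   = ⊥-elim (a≉0 a≈0)
  ... | inj₂ u-v≈0 = x∙y⁻¹≈ε⇒x≈y u v u-v≈0

module ExchangeRelation {c ℓ} (K : Field c ℓ) {n} (Q : Quiver n)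
                        (x₀ : Fin n → Field.Carrier K) where
  open Cluster K Q x₀
  open Field K using (Carrier; _≈_; _+_; _*_; _⁻¹; 0#; 1#)

  matrix : List (Fin n) → Fin n → Fin n → ℤ
  matrix ks = proj₂ (seedAt ks)

  matrix-skew : ∀ ks → Skew (matrix ks)
  matrix-skew []       = exchangeMatrix-skew Q
  matrix-skew (k ∷ ks) = mutateMatrix-skew k (matrix-skew ks)

  InA-pow : ∀ {y} → InA y → ∀ e → InA (pow K y e)
  InA-pow y zero    = one
  InA-pow y (suc e) = mul y (InA-pow y e)

  InA-prodFin : ∀ {m} {f : Fin m → Carrier} → (∀ j → InA (f j)) → InA (prodFin K f)
  InA-prodFin {zero}  g = one
  InA-prodFin {suc m} g = mul (g Fin.zero) (InA-prodFin (λ j → g (Fin.suc j)))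

  monomial⁺ monomial⁻ : List (Fin n) → Fin n → Carrier
  monomial⁺ ks k = prodFin K (λ j → pow K (cluster ks j) (pos (matrix ks j k)))
  monomial⁻ ks k = prodFin K (λ j → pow K (cluster ks j) (neg (matrix ks j k)))

  InA-monomial⁺ : ∀ ks k → InA (monomial⁺ ks k)
  InA-monomial⁺ ks k = InA-prodFin (λ j → InA-pow (var ks j) (pos (matrix ks j k)))

  InA-monomial⁻ : ∀ ks k → InA (monomial⁻ ks k)
  InA-monomial⁻ ks k = InA-prodFin (λ j → InA-pow (var ks j) (neg (matrix ks j k)))

  cluster-mutate-≢ : ∀ ks {k i} → ¬ (i ≡ k) → cluster (k ∷ ks) i ≡ cluster ks i
  cluster-mutate-≢ ks {k} {i} i≢k with i ≟ k
  ... | yes i≡k = ⊥-elim (i≢k i≡k)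
  ... | no _    = refl

  exchange : ∀ ks k → ¬ (cluster ks k ≈ 0#) →
    cluster ks k * cluster (k ∷ ks) k ≈ monomial⁺ ks k + monomial⁻ ks k
  exchange ks k xₖ≉0 with k ≟ k
  ... | no k≢k = ⊥-elim (k≢k refl)
  ... | yes _  = begin
    x * ((P⁺ + P⁻) * x ⁻¹)  ≈⟨ *-comm x _ ⟩
    ((P⁺ + P⁻) * x ⁻¹) * x  ≈⟨ *-assoc _ _ _ ⟩
    (P⁺ + P⁻) * (x ⁻¹ * x)  ≈⟨ *-congˡ (trans (*-comm _ _) (inverse x xₖ≉0)) ⟩
    (P⁺ + P⁻) * 1#          ≈⟨ *-identityʳ _ ⟩
    P⁺ + P⁻                 ∎
    where
    open Field K using (setoid; trans; *-comm; *-assoc; *-congˡ; *-identityʳ; inverse)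
    open SetoidReasoning setoid
    x   = cluster ks k
    P⁺  = monomial⁺ ks k
    P⁻  = monomial⁻ ks k

  module _ {c' ℓ'} (R : IntegralDomain c' ℓ') where
    private module R = IntegralDomain R
    open Frieze

    nonZero⇒cluster≉0 : (G : Frieze R) → NonZero R G → ∀ ks i → ¬ (cluster ks i ≈ 0#)
    nonZero⇒cluster≉0 G nonZero ks i xᵢ≈0 =
      nonZero ks i (R.trans (map-cong G (var ks i) zro xᵢ≈0) (map-0 G))

    frieze-exchange : (G : Frieze R) → ∀ ks k → ¬ (cluster ks k ≈ 0#) →
      map G (var ks k) R.* map G (var (k ∷ ks) k)
        R.≈ map G (InA-monomial⁺ ks k) R.+ map G (InA-monomial⁻ ks k)
    frieze-exchange G ks k xₖ≉0 = begin
      map G xₖ R.* map G xₖ'          ≈⟨ map-* G xₖ xₖ' ⟨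
      map G (mul xₖ xₖ')              ≈⟨ map-cong G (mul xₖ xₖ') (add P⁺ P⁻) (exchange ks k xₖ≉0) ⟩
      map G (add P⁺ P⁻)               ≈⟨ map-+ G P⁺ P⁻ ⟩
      map G P⁺ R.+ map G P⁻           ∎
      where
      open SetoidReasoning R.setoid
      xₖ  = var ks k
      xₖ' = var (k ∷ ks) k
      P⁺  = InA-monomial⁺ ks k
      P⁻  = InA-monomial⁻ ks k

module Agreement {c ℓ c' ℓ'} (K : Field c ℓ) {n} (Q : Quiver n)
                 (x₀ : Fin n → Field.Carrier K) (R : IntegralDomain c' ℓ')
                 (F F' : Cluster.Frieze K Q x₀ R) where
  open Cluster K Q x₀
  open ExchangeRelation K Q x₀
  private
    module K = Field K
    module R = IntegralDomain R
  open Frieze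

  Agree : ∀ {a} → InA a → Set ℓ'
  Agree p = map F p R.≈ map F' p

  AgreeOn : List (Fin n) → Set ℓ'
  AgreeOn ks = ∀ i → Agree (var ks i)

  agree-cong : ∀ {a b} (p : InA a) (q : InA b) → a K.≈ b → Agree p → Agree q
  agree-cong p q a≈b agree =
    R.trans (R.sym (map-cong F p q a≈b)) (R.trans agree (map-cong F' p q a≈b))

  agree-0 : Agree zro
  agree-0 = R.trans (map-0 F) (R.sym (map-0 F'))

  agree-1 : Agree one
  agree-1 = R.trans (map-1 F) (R.sym (map-1 F'))

  agree-+ : ∀ {a b} {p : InA a} {q : InA b} → Agree p → Agree q → Agree (add p q)
  agree-+ {p = p} {q} agreeᵖ agreeᵠ =
    R.trans (map-+ F p q) (R.trans (R.+-cong agreeᵖ agreeᵠ) (R.sym (map-+ F' p q)))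

  agree-* : ∀ {a b} {p : InA a} {q : InA b} → Agree p → Agree q → Agree (mul p q)
  agree-* {p = p} {q} agreeᵖ agreeᵠ =
    R.trans (map-* F p q) (R.trans (R.*-cong agreeᵖ agreeᵠ) (R.sym (map-* F' p q)))

  agree-neg : ∀ {a} {p : InA a} → Agree p → Agree (negA p)
  agree-neg {p = p} agreeᵖ =
    R.trans (map-neg F p) (R.trans (R.-‿cong agreeᵖ) (R.sym (map-neg F' p)))

  agree-pow : ∀ {y} (p : InA y) e → e ≡ 0 ⊎ Agree p → Agree (InA-pow p e)
  agree-pow p zero    _             = agree-1
  agree-pow p (suc e) (inj₁ ())
  agree-pow p (suc e) (inj₂ agreeᵖ) = agree-* agreeᵖ (agree-pow p e (inj₂ agreeᵖ))

  agree-prodFin : ∀ {m} {f : Fin m → K.Carrier} {g : ∀ j → InA (f j)} →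
    (∀ j → Agree (g j)) → Agree (InA-prodFin g)
  agree-prodFin {zero}  _     = agree-1
  agree-prodFin {suc m} agree = agree-* (agree Fin.zero) (agree-prodFin (λ j → agree (Fin.suc j)))

  agree-InA : (∀ ks → AgreeOn ks) → ∀ {a} (p : InA a) → Agree p
  agree-InA agree (var ks i) = agree ks i
  agree-InA agree zro        = agree-0
  agree-InA agree one        = agree-1
  agree-InA agree (add p q)  = agree-+ (agree-InA agree p) (agree-InA agree q)
  agree-InA agree (mul p q)  = agree-* (agree-InA agree p) (agree-InA agree q)
  agree-InA agree (negA p)   = agree-neg (agree-InA agree p)

  agree-monomials : ∀ ks k → (∀ j → ¬ (j ≡ k) → Agree (var ks j)) →
    Agree (InA-monomial⁺ ks k) × Agree (InA-monomial⁻ ks k)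
  agree-monomials ks k agree = agree-prodFin exponent⁺ , agree-prodFin exponent⁻
    where
    exponent⁺ : ∀ j → Agree (InA-pow (var ks j) (pos (matrix ks j k)))
    exponent⁺ j with j ≟ k
    ... | yes refl = agree-pow _ _ (inj₁ (skew⇒pos-diagonal≡0 (matrix-skew ks) j))
    ... | no j≢k   = agree-pow _ _ (inj₂ (agree j j≢k))
    exponent⁻ : ∀ j → Agree (InA-pow (var ks j) (neg (matrix ks j k)))
    exponent⁻ j with j ≟ k
    ... | yes refl = agree-pow _ _ (inj₁ (skew⇒neg-diagonal≡0 (matrix-skew ks) j))
    ... | no j≢k   = agree-pow _ _ (inj₂ (agree j j≢k))

  module _ (nonZero : NonZero R F) where

    -- F' need not be non-zero: the exchange relation holds in K as soon as x_k ≉ 0.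
    agree-exchangePair : ∀ ks k → (∀ j → ¬ (j ≡ k) → Agree (var ks j)) →
      map F (var ks k) R.* map F (var (k ∷ ks) k)
        R.≈ map F' (var ks k) R.* map F' (var (k ∷ ks) k)
    agree-exchangePair ks k agree = begin
      map F xₖ R.* map F xₖ'          ≈⟨ frieze-exchange R F ks k xₖ≉0 ⟩
      map F P⁺ R.+ map F P⁻           ≈⟨ R.+-cong agree⁺ agree⁻ ⟩
      map F' P⁺ R.+ map F' P⁻         ≈⟨ frieze-exchange R F' ks k xₖ≉0 ⟨
      map F' xₖ R.* map F' xₖ'        ∎
      where
      open SetoidReasoning R.setoid
      xₖ  = var ks k
      xₖ' = var (k ∷ ks) k
      P⁺  = InA-monomial⁺ ks k
      P⁻  = InA-monomial⁻ ks k
      xₖ≉0 = nonZero⇒cluster≉0 R F nonZero ks k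
      agree⁺ = proj₁ (agree-monomials ks k agree)
      agree⁻ = proj₂ (agree-monomials ks k agree)

    agree-mutated : ∀ ks k → AgreeOn ks → Agree (var (k ∷ ks) k)
    agree-mutated ks k agree = *-cancelˡ-nonZero R (map F xₖ) (nonZero ks k) (begin
      map F xₖ R.* map F xₖ'   ≈⟨ agree-exchangePair ks k (λ j _ → agree j) ⟩
      map F' xₖ R.* map F' xₖ' ≈⟨ R.*-congʳ (agree k) ⟨
      map F xₖ R.* map F' xₖ'  ∎)
      where
      open SetoidReasoning R.setoid
      xₖ  = var ks k
      xₖ' = var (k ∷ ks) k

    agree-unmutated : ∀ ks k → AgreeOn (k ∷ ks) → Agree (var ks k)
    agree-unmutated ks k agree = *-cancelˡ-nonZero R (map F xₖ') (nonZero (k ∷ ks) k) (begin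
      map F xₖ' R.* map F xₖ   ≈⟨ R.*-comm _ _ ⟩
      map F xₖ R.* map F xₖ'   ≈⟨ agree-exchangePair ks k agreeOthers ⟩
      map F' xₖ R.* map F' xₖ' ≈⟨ R.*-congˡ (agree k) ⟨
      map F' xₖ R.* map F xₖ'  ≈⟨ R.*-comm _ _ ⟩
      map F xₖ' R.* map F' xₖ  ∎)
      where
      open SetoidReasoning R.setoid
      xₖ  = var ks k
      xₖ' = var (k ∷ ks) k
      agreeOthers : ∀ j → ¬ (j ≡ k) → Agree (var ks j)
      agreeOthers j j≢k = agree-cong (var (k ∷ ks) j) (var ks j)
                            (K.reflexive (cluster-mutate-≢ ks j≢k)) (agree j)

    agree-mutate : ∀ ks k → AgreeOn ks → AgreeOn (k ∷ ks)
    agree-mutate ks k agree i = byCases (i ≟ k)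
      where
      byCases : Dec (i ≡ k) → Agree (var (k ∷ ks) i)
      byCases (yes i≡k) = subst (λ j → Agree (var (k ∷ ks) j)) (sym i≡k)
                                (agree-mutated ks k agree)
      byCases (no i≢k)  = agree-cong (var ks i) (var (k ∷ ks) i)
                            (K.reflexive (sym (cluster-mutate-≢ ks i≢k))) (agree i)

    agree-unmutate : ∀ ks k → AgreeOn (k ∷ ks) → AgreeOn ks
    agree-unmutate ks k agree i = byCases (i ≟ k)
      where
      byCases : Dec (i ≡ k) → Agree (var ks i)
      byCases (yes i≡k) = subst (λ j → Agree (var ks j)) (sym i≡k)
                                (agree-unmutated ks k agree)
      byCases (no i≢k)  = agree-cong (var (k ∷ ks) i) (var ks i)
                            (K.reflexive (cluster-mutate-≢ ks i≢k)) (agree i)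

    agree-initial : ∀ ks → AgreeOn ks → AgreeOn []
    agree-initial []       agree = agree
    agree-initial (k ∷ ks) agree = agree-initial ks (agree-unmutate ks k agree)

    agree-fromInitial : ∀ ks → AgreeOn [] → AgreeOn ks
    agree-fromInitial []       agree = agree
    agree-fromInitial (k ∷ ks) agree = agree-mutate ks k (agree-fromInitial ks agree)

proposition3p1 : ∀ {c ℓ c' ℓ'} (K : Field c ℓ) {n} (Q : Quiver n)
    (x₀ : Fin n → Field.Carrier K) → AlgIndependent K x₀ →
    (R : IntegralDomain c' ℓ') →
    (F F' : Cluster.Frieze K Q x₀ R) →
    Cluster.NonZero K Q x₀ R F → Cluster.NonZero K Q x₀ R F' →
    (ks : List (Fin n)) →
    (∀ i → IntegralDomain._≈_ R (Cluster.Frieze.map F (Cluster.var ks i))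
                                 (Cluster.Frieze.map F' (Cluster.var ks i))) →
    ∀ {a} (p : Cluster.InA K Q x₀ a) →
      IntegralDomain._≈_ R (Cluster.Frieze.map F p)
                           (Cluster.Frieze.map F' p)
proposition3p1 K Q x₀ _ R F F' nonZero _ ks agree =
  agree-InA (λ ks' → agree-fromInitial nonZero ks' (agree-initial nonZero ks agree))
  where open Agreement K Q x₀ R F F'
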